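{- Let $n,m$ be integers with $2\le m\le n$. Put $D=(2n+1)(1-3m+3m^2+n+n^2)$, $$A=3m^3+(-1+3m+3m^2)n+(3m-1)n^2-n^3,\qquad B=1-3m^2+3m^3+(2+3m-3m^2)n+(3m+2)n^2+n^3,$$ and $a=\frac{(n-(m-1))A}{D}$, $b=\frac{(n+m)B}{D}$. Then the sequence $(1,2,\dots,m-1,m+1,m+2,\dots,n,a,b)$ (the integers $1,\dots,n$ with $m$ removed, together with $a$ and $b$) satisfies $\nu=0$.
   Context: For a finite sequence $(a_1,\dots,a_N)$ of rational numbers, $\nu(a_1,\dots,a_N)=\big(\sum a_i\big)^2-\sum a_i^3$. -}

module Defs where

open import Data.Nat as ℕ using (ℕ; suc)
open import Data.Integer as ℤ using (ℤ; +_)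
open import Data.Rational as ℚ using (ℚ; _+_; _*_; _-_; _÷_; 0ℚ; 1ℚ)
open import Data.Rational.Properties
open import Data.List using (List; _∷_; []; _++_; filter; map; upTo)
open import Relation.Nullary.Decidable using (¬?)
open import Relation.Binary.PropositionalEquality
open import Data.Sum using (inj₁; inj₂)

sumℚ : List ℚ → ℚ
sumℚ [] = 0ℚ
sumℚ (x ∷ xs) = x + sumℚ xs

ν : List ℚ → ℚ
ν xs = sumℚ xs * sumℚ xs - sumℚ (map (λ x → x * x * x) xs)

q : ℕ → ℚ
q k = + k ℚ./ 1

D : ℕ → ℕ → ℚ
D n m = (q 2 * q n + 1ℚ) * (1ℚ - q 3 * q m + q 3 * q m * q m + q n + q n * q n)

A : ℕ → ℕ → ℚ
A n m = q 3 * q m * q m * q m + (ℚ.- 1ℚ + q 3 * q m + q 3 * q m * q m) * q n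
        + (q 3 * q m - 1ℚ) * q n * q n - q n * q n * q n

B : ℕ → ℕ → ℚ
B n m = 1ℚ - q 3 * q m * q m + q 3 * q m * q m * q m
        + (q 2 + q 3 * q m - q 3 * q m * q m) * q n
        + (q 3 * q m + q 2) * q n * q n + q n * q n * q n

sq-nonNeg : ∀ p → ℚ.NonNegative (p * p)
sq-nonNeg p with ≤-total 0ℚ p
... | inj₁ 0≤p = nonNeg*nonNeg⇒nonNeg p {{ℚ.nonNegative 0≤p}} p {{ℚ.nonNegative 0≤p}}
... | inj₂ p≤0 = nonPos*nonPos⇒nonPos p {{ℚ.nonPositive p≤0}} p {{ℚ.nonPositive p≤0}}

q-nonNeg : ∀ k → ℚ.NonNegative (q k)
q-nonNeg k = normalize-nonNeg k 1

¼ : ℚ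
¼ = + 1 ℚ./ 4

D-X : ∀ n m → (1ℚ - q 3 * q m + q 3 * q m * q m + q n + q n * q n)
             ≡ (¼ + q 3 * ((q m - ℚ.½) * (q m - ℚ.½))) + (q n + q n * q n)
D-X n m = solve 2 (λ x y → con 1ℚ :- con (q 3) :* x :+ con (q 3) :* x :* x :+ y :+ y :* y
                       := (con ¼ :+ con (q 3) :* ((x :- con ℚ.½) :* (x :- con ℚ.½))) :+ (y :+ y :* y)) refl (q m) (q n)
  where
  open import Data.Rational.Solver using (module +-*-Solver)
  open +-*-Solver

D-pos : ∀ n m → ℚ.Positive (D n m)
D-pos n m = subst ℚ.Positive (cong ((q 2 * q n + 1ℚ) *_) (sym (D-X n m)))
  (pos*pos⇒pos (q 2 * q n + 1ℚ) {{L}} ((¼ + q 3 * ((q m - ℚ.½) * (q m - ℚ.½))) + (q n + q n * q n)) {{R}})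
  where
  instance
    yN = q-nonNeg n
    y2N = nonNeg*nonNeg⇒nonNeg (q n) (q n)
    sqN = sq-nonNeg (q m - ℚ.½)
    3sqN = nonNeg*nonNeg⇒nonNeg (q 3) {{q-nonNeg 3}} ((q m - ℚ.½) * (q m - ℚ.½))
    yyN = nonNeg+nonNeg⇒nonNeg (q n) (q n * q n)
    2yN = nonNeg*nonNeg⇒nonNeg (q 2) {{q-nonNeg 2}} (q n)
  L : ℚ.Positive (q 2 * q n + 1ℚ)
  L = nonNeg+pos⇒pos (q 2 * q n) 1ℚ
  R : ℚ.Positive ((¼ + q 3 * ((q m - ℚ.½) * (q m - ℚ.½))) + (q n + q n * q n))
  R = pos+nonNeg⇒pos (¼ + q 3 * ((q m - ℚ.½) * (q m - ℚ.½))) {{pos+nonNeg⇒pos ¼ (q 3 * ((q m - ℚ.½) * (q m - ℚ.½)))}} (q n + q n * q n)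

instance
  D-nonZero : ∀ {n m} → ℚ.NonZero (D n m)
  D-nonZero {n} {m} = pos⇒nonZero (D n m) {{D-pos n m}}

{-# OPTIONS --safe #-}
-- Removing m from 1, …, n leaves a sum T − m and a sum of cubes T² − m³,
-- where T = n(n+1)/2 (Gauss and Nicomachus). With a = x/D and b = y/D,
-- ν = (T − m + a + b)² − (T² − m³ + a³ + b³) equals D⁻³ times the polynomial
-- ((T − m)D + x + y)²D − (T² − m³)D³ − x³ − y³ in n and m, and for the given
-- x = (n − (m − 1))A and y = (n + m)B this polynomial vanishes identically.
module Submission where

open import Defs
open import Data.Nat as ℕ using (ℕ; zero; suc; _≤_; _<_; _≟_; s≤s)
import Data.Nat.Properties as ℕ
open import Data.Nat.Coprimality as Coprime using (1-coprimeTo)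
import Data.Integer as ℤ
open import Data.Rational as ℚ using (ℚ; _*_; _-_; _+_; _÷_; 1/_; 0ℚ; 1ℚ; ½; mkℚ; toℚᵘ)
open import Data.Rational.Properties
  using (+-0-group; +-identityˡ; +-identityʳ; +-assoc; *-zeroˡ; *-inverseʳ; normalize-coprime; toℚᵘ-injective; toℚᵘ-homo-+)
import Data.Rational.Unnormalised as ℚᵘ
import Data.Rational.Unnormalised.Properties as ℚᵘ
open import Data.Rational.Solver using (module +-*-Solver)
open import Algebra.Properties.Group +-0-group using (//-rightDividesʳ)
open import Data.List using (List; _∷_; []; _++_; filter; map; upTo)
import Data.List.Properties as List
open import Relation.Nullary using (yes; no)
open import Relation.Nullary.Decidable using (¬?)
open import Data.Empty using (⊥-elim)
open import Function using (_∘_)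
open import Relation.Binary.PropositionalEquality using (_≡_; _≢_; refl; sym; trans; cong; cong₂; module ≡-Reasoning)

open +-*-Solver
open ≡-Reasoning

cube : ℚ → ℚ
cube x = x * x * x

triangular : ℚ → ℚ
triangular N = N * (N + 1ℚ) * ½

sumTo : (ℕ → ℚ) → ℕ → ℚ
sumTo f zero    = 0ℚ
sumTo f (suc n) = sumTo f n + f (suc n)

range : ℕ → List ℕ
range n = map suc (upTo n)

without : ℕ → List ℕ → List ℕ
without m = filter (λ k → ¬? (k ≟ m))

sumℚ-++ : ∀ xs ys → sumℚ (xs ++ ys) ≡ sumℚ xs + sumℚ ys
sumℚ-++ []       ys = sym (+-identityˡ (sumℚ ys))
sumℚ-++ (x ∷ xs) ys = trans (cong (x +_) (sumℚ-++ xs ys)) (sym (+-assoc x (sumℚ xs) (sumℚ ys)))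

range-suc : ∀ n → range (suc n) ≡ range n ++ suc n ∷ []
range-suc n = trans (cong (map suc) (sym (List.upTo-∷ʳ n))) (List.map-++ suc (upTo n) (n ∷ []))

sum-without-++ : ∀ f m xs ys →
  sumℚ (map f (without m (xs ++ ys))) ≡ sumℚ (map f (without m xs)) + sumℚ (map f (without m ys))
sum-without-++ f m xs ys = begin
  sumℚ (map f (without m (xs ++ ys)))
    ≡⟨ cong (sumℚ ∘ map f) (List.filter-++ (λ k → ¬? (k ≟ m)) xs ys) ⟩
  sumℚ (map f (without m xs ++ without m ys))
    ≡⟨ cong sumℚ (List.map-++ f (without m xs) (without m ys)) ⟩
  sumℚ (map f (without m xs) ++ map f (without m ys))
    ≡⟨ sumℚ-++ (map f (without m xs)) (map f (without m ys)) ⟩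
  sumℚ (map f (without m xs)) + sumℚ (map f (without m ys)) ∎

sum-without-range-suc : ∀ f m n →
  sumℚ (map f (without m (range (suc n)))) ≡ sumℚ (map f (without m (range n))) + sumℚ (map f (without m (suc n ∷ [])))
sum-without-range-suc f m n =
  trans (cong (sumℚ ∘ map f ∘ without m) (range-suc n)) (sum-without-++ f m (range n) (suc n ∷ []))

sum-without-[k] : ∀ f {m k} → k ≢ m → sumℚ (map f (without m (k ∷ []))) ≡ f k
sum-without-[k] f {m} k≢m =
  trans (cong (sumℚ ∘ map f) (List.filter-accept (λ j → ¬? (j ≟ m)) k≢m)) (+-identityʳ _)

sum-without-[m] : ∀ f m → sumℚ (map f (without m (m ∷ []))) ≡ 0ℚ
sum-without-[m] f m = cong (sumℚ ∘ map f) (List.filter-reject (λ j → ¬? (j ≟ m)) (λ m≢m → m≢m refl))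

sum-without-range-< : ∀ f m n → n < m → sumℚ (map f (without m (range n))) ≡ sumTo f n
sum-without-range-< f m zero    _ = refl
sum-without-range-< f m (suc n) n<m with suc n ≟ m
... | yes n≡m = ⊥-elim (ℕ.<-irrefl n≡m n<m)
... | no  n≢m = trans (sum-without-range-suc f m n)
  (cong₂ _+_ (sum-without-range-< f m n (ℕ.<-trans (ℕ.n<1+n n) n<m)) (sum-without-[k] f n≢m))

sum-without-range : ∀ f {m n} → 1 ≤ m → m ≤ n → sumℚ (map f (without m (range n))) ≡ sumTo f n - f m
sum-without-range f {n = zero}  (s≤s _) ()
sum-without-range f {m} {suc n} 1≤m m≤1+n with suc n ≟ m
... | yes refl = begin
  sumℚ (map f (without (suc n) (range (suc n))))   ≡⟨ sum-without-range-suc f (suc n) n ⟩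
  sumℚ (map f (without (suc n) (range n)))
    + sumℚ (map f (without (suc n) (suc n ∷ []))) ≡⟨ cong₂ _+_ (sum-without-range-< f (suc n) n (ℕ.n<1+n n))
                                                                 (sum-without-[m] f (suc n)) ⟩
  sumTo f n + 0ℚ                                    ≡⟨ +-identityʳ (sumTo f n) ⟩
  sumTo f n                                         ≡⟨ //-rightDividesʳ (f (suc n)) (sumTo f n) ⟨
  sumTo f (suc n) - f (suc n)                       ∎
... | no  1+n≢m = begin
  sumℚ (map f (without m (range (suc n))))          ≡⟨ sum-without-range-suc f m n ⟩
  sumℚ (map f (without m (range n)))
    + sumℚ (map f (without m (suc n ∷ [])))         ≡⟨ cong₂ _+_ (sum-without-range f 1≤m m≤n) (sum-without-[k] f 1+n≢m) ⟩
  sumTo f n - f m + f (suc n)                       ≡⟨ solve 3 (λ a b c → a :- c :+ b := a :+ b :- c) refl (sumTo f n) (f (suc n)) (f m) ⟩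
  sumTo f (suc n) - f m                             ∎
  where
  m≤n : m ≤ n
  m≤n = ℕ.s≤s⁻¹ (ℕ.≤∧≢⇒< m≤1+n (1+n≢m ∘ sym))

cleared : ℚ → ℚ → ℚ → ℚ → ℚ → ℚ
cleared s c x y d = (s * d + x + y) * (s * d + x + y) * d - c * cube d - cube x - cube y

-- Each primed solver expression evaluates definitionally to its unprimed namesake,
-- so solve can prove statements about cube, triangular, cleared, D, A and B.
module _ {k : ℕ} where
  cube′ : Polynomial k → Polynomial k
  cube′ x = x :* x :* x

  triangular′ : Polynomial k → Polynomial k
  triangular′ N = N :* (N :+ con 1ℚ) :* con ½

  cleared′ : Polynomial k → Polynomial k → Polynomial k → Polynomial k → Polynomial k → Polynomial k
  cleared′ s c x y d = (s :* d :+ x :+ y) :* (s :* d :+ x :+ y) :* d :- c :* cube′ d :- cube′ x :- cube′ y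

  D′ A′ B′ : Polynomial k → Polynomial k → Polynomial k
  D′ N M = (con (q 2) :* N :+ con 1ℚ) :* (con 1ℚ :- con (q 3) :* M :+ con (q 3) :* M :* M :+ N :+ N :* N)
  A′ N M = con (q 3) :* M :* M :* M :+ (:- con 1ℚ :+ con (q 3) :* M :+ con (q 3) :* M :* M) :* N
           :+ (con (q 3) :* M :- con 1ℚ) :* N :* N :- N :* N :* N
  B′ N M = con 1ℚ :- con (q 3) :* M :* M :+ con (q 3) :* M :* M :* M
           :+ (con (q 2) :+ con (q 3) :* M :- con (q 3) :* M :* M) :* N
           :+ (con (q 3) :* M :+ con (q 2)) :* N :* N :+ N :* N :* N

q-canonical : ∀ k → q k ≡ mkℚ (ℤ.+ k) 0 (Coprime.sym (1-coprimeTo k))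
q-canonical k = normalize-coprime (Coprime.sym (1-coprimeTo k))

q-suc : ∀ n → q (suc n) ≡ 1ℚ + q n
q-suc n = toℚᵘ-injective (ℚᵘ.≃-trans (q-sucᵘ n) (ℚᵘ.≃-sym (toℚᵘ-homo-+ 1ℚ (q n))))
  where
  -- The split on n lets the sign-magnitude product in ℤ compute.
  q-sucᵘ : ∀ n → toℚᵘ (q (suc n)) ℚᵘ.≃ toℚᵘ 1ℚ ℚᵘ.+ toℚᵘ (q n)
  q-sucᵘ n rewrite q-canonical (suc n) | q-canonical n | ℕ.*-identityʳ n with n
  ... | zero  = ℚᵘ.*≡* refl
  ... | suc _ = ℚᵘ.*≡* refl

sumTo-q : ∀ n → sumTo q n ≡ triangular (q n)
sumTo-q zero    = refl
sumTo-q (suc n) = begin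
  sumTo q n + q (suc n)           ≡⟨ cong₂ _+_ (sumTo-q n) (q-suc n) ⟩
  triangular (q n) + (1ℚ + q n)   ≡⟨ solve 1 (λ N → triangular′ N :+ (con 1ℚ :+ N) := triangular′ (con 1ℚ :+ N)) refl (q n) ⟩
  triangular (1ℚ + q n)           ≡⟨ cong triangular (q-suc n) ⟨
  triangular (q (suc n))          ∎

sumTo-cube : ∀ n → sumTo (cube ∘ q) n ≡ triangular (q n) * triangular (q n)
sumTo-cube zero    = refl
sumTo-cube (suc n) = begin
  sumTo (cube ∘ q) n + cube (q (suc n))                     ≡⟨ cong₂ _+_ (sumTo-cube n) (cong cube (q-suc n)) ⟩
  triangular (q n) * triangular (q n) + cube (1ℚ + q n)     ≡⟨ solve 1 (λ N → triangular′ N :* triangular′ N :+ cube′ (con 1ℚ :+ N)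
                                                                        := triangular′ (con 1ℚ :+ N) :* triangular′ (con 1ℚ :+ N)) refl (q n) ⟩
  triangular (1ℚ + q n) * triangular (1ℚ + q n)             ≡⟨ cong (λ N → triangular N * triangular N) (q-suc n) ⟨
  triangular (q (suc n)) * triangular (q (suc n))           ∎

ν-++ : ∀ xs ys → ν (xs ++ ys) ≡
  (sumℚ xs + sumℚ ys) * (sumℚ xs + sumℚ ys) - (sumℚ (map cube xs) + sumℚ (map cube ys))
ν-++ xs ys rewrite List.map-++ cube xs ys | sumℚ-++ xs ys | sumℚ-++ (map cube xs) (map cube ys) = refl

-- cleared is homogeneous of degree 3 in (x, y, d), so scaling by i = 1/d sends d to 1.
clear-denominators : ∀ s c x y d i → d * i ≡ 1ℚ →
  (s + (x * i + (y * i + 0ℚ))) * (s + (x * i + (y * i + 0ℚ))) - (c + (cube (x * i) + (cube (y * i) + 0ℚ)))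
    ≡ cleared s c x y d * cube i
clear-denominators s c x y d i d*i≡1 = begin
  (s + (x * i + (y * i + 0ℚ))) * (s + (x * i + (y * i + 0ℚ))) - (c + (cube (x * i) + (cube (y * i) + 0ℚ)))
    ≡⟨ solve 4 (λ s c a b → (s :+ (a :+ (b :+ con 0ℚ))) :* (s :+ (a :+ (b :+ con 0ℚ))) :- (c :+ (cube′ a :+ (cube′ b :+ con 0ℚ)))
                            := cleared′ s c a b (con 1ℚ)) refl s c (x * i) (y * i) ⟩
  cleared s c (x * i) (y * i) 1ℚ
    ≡⟨ cong (cleared s c (x * i) (y * i)) d*i≡1 ⟨
  cleared s c (x * i) (y * i) (d * i)
    ≡⟨ solve 6 (λ s c x y d i → cleared′ s c (x :* i) (y :* i) (d :* i) := cleared′ s c x y d :* cube′ i) refl s c x y d i ⟩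
  cleared s c x y d * cube i
    ∎

ν-append-fractions : ∀ xs x y d .{{_ : ℚ.NonZero d}} →
  ν (xs ++ x ÷ d ∷ y ÷ d ∷ []) ≡ cleared (sumℚ xs) (sumℚ (map cube xs)) x y d * cube (1/ d)
ν-append-fractions xs x y d = trans (ν-++ xs (x ÷ d ∷ y ÷ d ∷ []))
  (clear-denominators (sumℚ xs) (sumℚ (map cube xs)) x y d (1/ d) (*-inverseʳ d))

ν-append-fractions-≡0 : ∀ xs x y d .{{_ : ℚ.NonZero d}} →
  cleared (sumℚ xs) (sumℚ (map cube xs)) x y d ≡ 0ℚ → ν (xs ++ x ÷ d ∷ y ÷ d ∷ []) ≡ 0ℚ
ν-append-fractions-≡0 xs x y d cleared≡0 = begin
  ν (xs ++ x ÷ d ∷ y ÷ d ∷ [])                                ≡⟨ ν-append-fractions xs x y d ⟩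
  cleared (sumℚ xs) (sumℚ (map cube xs)) x y d * cube (1/ d)  ≡⟨ cong (_* cube (1/ d)) cleared≡0 ⟩
  0ℚ * cube (1/ d)                                            ≡⟨ *-zeroˡ (cube (1/ d)) ⟩
  0ℚ                                                          ∎

cleared-vanishes : ∀ n m →
  cleared (triangular (q n) - q m) (triangular (q n) * triangular (q n) - cube (q m))
          ((q n - (q m - q 1)) * A n m) ((q n + q m) * B n m) (D n m) ≡ 0ℚ
cleared-vanishes n m = solve 2 (λ N M →
  cleared′ (triangular′ N :- M) (triangular′ N :* triangular′ N :- cube′ M)
           ((N :- (M :- con 1ℚ)) :* A′ N M) ((N :+ M) :* B′ N M) (D′ N M) := con 0ℚ) refl (q n) (q m)

mainTheorem9 : ∀ (n m : ℕ) → 2 ≤ m → m ≤ n →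
    ν (map q (filter (λ k → ¬? (k ≟ m)) (map suc (upTo n)))
       ++ (((q n - (q m - q 1)) * A n m) ÷ D n m) {{D-nonZero {n} {m}}}
       ∷ (((q n + q m) * B n m) ÷ D n m) {{D-nonZero {n} {m}}}
       ∷ []) ≡ 0ℚ
mainTheorem9 n m 2≤m m≤n = ν-append-fractions-≡0 xs x y (D n m) {{D-nonZero {n} {m}}} (begin
  cleared (sumℚ xs) (sumℚ (map cube xs)) x y (D n m)  ≡⟨ cong₂ (λ s c → cleared s c x y (D n m)) sum-xs sum-cubes-xs ⟩
  cleared (T - q m) (T * T - cube (q m)) x y (D n m)  ≡⟨ cleared-vanishes n m ⟩
  0ℚ                                                  ∎)
  where
  xs = map q (without m (range n))
  x  = (q n - (q m - q 1)) * A n m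
  y  = (q n + q m) * B n m
  T  = triangular (q n)
  1≤m = ℕ.≤-trans (ℕ.n≤1+n 1) 2≤m
  sum-xs : sumℚ xs ≡ T - q m
  sum-xs = trans (sum-without-range q 1≤m m≤n) (cong (_- q m) (sumTo-q n))
  sum-cubes-xs : sumℚ (map cube xs) ≡ T * T - cube (q m)
  sum-cubes-xs = begin
    sumℚ (map cube xs)                            ≡⟨ cong sumℚ (List.map-∘ (without m (range n))) ⟨
    sumℚ (map (cube ∘ q) (without m (range n)))   ≡⟨ sum-without-range (cube ∘ q) 1≤m m≤n ⟩
    sumTo (cube ∘ q) n - cube (q m)               ≡⟨ cong (_- cube (q m)) (sumTo-cube n) ⟩
    T * T - cube (q m)                            ∎
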